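{- Let $k$ be an ordinal that is either finite or equal to $\omega$, and let $f\colon A\to B$ be a morphism of the category $\mathbf{S}_k$. The following are equivalent: (1) $f$ is a monomorphism in $\mathbf{S}_k$; (2) $f$ is injective; (3) $f$ is an embedding of Kripke models.
   Context: A Kripke model $(A,R,a)$ is a set $A$ with a binary relation $R$ (accessibility), a subset $\mathscr{P}^A\subseteq A$ for each unary relation symbol $\mathscr{P}$ of a fixed vocabulary, and a distinguished element $a$. A homomorphism $f\colon (A,a)\to(B,b)$ is a function preserving the accessibility relation and all unary relations and with $f(a)=b$. A Kripke model $(C,c)$ is a synchronization tree if for every $x\in C$ there is a unique finite sequence $c_0 R c_1 R\cdots R c_n$ with $c_0=c$, $c_n=x$; then the reflexive transitive closure of $R$ is a tree order with root $c$. $\mathbf{T}_k$ is the category of synchronization trees of height at most $k$ (every branch from the root has at most $k$ elements) with homomorphisms. A homomorphism is a pathwise embedding if it also reflects all unary relations ($f(x)\in\mathscr{P}^B$ implies $x\in\mathscr{P}^A$). $\mathbf{S}_k$ is the wide subcategory of $\mathbf{T}_k$ whose morphisms are the pathwise embeddings. An embedding of Kripke models is an injective homomorphism that reflects both the unary relations and the accessibility relation. -}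

module Defs where

open import Data.Nat using (ℕ; _≤_)
open import Data.Unit using (⊤)
open import Data.List using (List; []; _∷_; length)
open import Data.Product using (Σ; _×_)
open import Relation.Binary.PropositionalEquality using (_≡_)
open import Function using (_⇔_)

record KripkeModel (I : Set) : Set₁ where
  field
    Carrier : Set
    R       : Carrier → Carrier → Set
    P       : I → Carrier → Set
    root    : Carrier
open KripkeModel public

-- Walk R c x xs : xs is the finite sequence c = c₀ R c₁ R ⋯ R cₙ = x
data Walk {A : Set} (R : A → A → Set) : A → A → List A → Set where
  one  : ∀ {c} → Walk R c c (c ∷ [])
  step : ∀ {c d x xs} → R c d → Walk R d x xs → Walk R c x (c ∷ xs)

IsSyncTree : ∀ {I} → KripkeModel I → Set
IsSyncTree M =
  ((x : Carrier M) → Σ (List (Carrier M)) (λ xs → Walk (R M) (root M) x xs))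
  × ((x : Carrier M) (xs ys : List (Carrier M)) →
       Walk (R M) (root M) x xs → Walk (R M) (root M) x ys → xs ≡ ys)

data Height : Set where
  fin : ℕ → Height
  ω   : Height

_≤ₕ_ : ℕ → Height → Set
n ≤ₕ fin k = n ≤ k
n ≤ₕ ω     = ⊤

HeightAtMost : ∀ {I} → Height → KripkeModel I → Set
HeightAtMost k M =
  (x : Carrier M) (xs : List (Carrier M)) → Walk (R M) (root M) x xs → length xs ≤ₕ k

record SyncTree (I : Set) (k : Height) : Set₁ where
  field
    model  : KripkeModel I
    isTree : IsSyncTree model
    height : HeightAtMost k model
open SyncTree public

record IsHomomorphism {I} (A B : KripkeModel I) (f : Carrier A → Carrier B) : Set where
  field
    pres-R    : ∀ {x y} → R A x y → R B (f x) (f y)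
    pres-P    : ∀ i {x} → P A i x → P B i (f x)
    pres-root : f (root A) ≡ root B

record IsPathwiseEmbedding {I} (A B : KripkeModel I) (f : Carrier A → Carrier B) : Set where
  field
    hom       : IsHomomorphism A B f
    reflect-P : ∀ i {x} → P B i (f x) → P A i x

Injective : {X Y : Set} → (X → Y) → Set
Injective f = ∀ {x y} → f x ≡ f y → x ≡ y

record IsEmbedding {I} (A B : KripkeModel I) (f : Carrier A → Carrier B) : Set where
  field
    injective : Injective f
    hom       : IsHomomorphism A B f
    reflect-P : ∀ i {x} → P B i (f x) → P A i x
    reflect-R : ∀ {x y} → R B (f x) (f y) → R A x y

record SMor {I k} (A B : SyncTree I k) : Set where
  field
    fun  : Carrier (model A) → Carrier (model B)
    isPE : IsPathwiseEmbedding (model A) (model B) fun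
open SMor public

-- Monomorphism in S_k (equality of morphisms = equality of underlying functions,
-- taken pointwise since Agda lacks function extensionality).
IsMonoS : ∀ {I k} {A B : SyncTree I k} → SMor A B → Set₁
IsMonoS {I} {k} {A} {B} f =
  (C : SyncTree I k) (g h : SMor C A) →
  (∀ c → fun f (fun g c) ≡ fun f (fun h c)) → ∀ c → fun g c ≡ fun h c

-- Injective maps into a tree reflect accessibility: if F x R F y, the parent
-- of y (which exists, since F y is not the root) is sent to the unique parent
-- F x of F y, so it is x.  For monos, test f against the two projections out
-- of its kernel pair {(a , b) | F a ≡ F b} with componentwise accessibility.
-- Since images of root walks in B are unique, two points with the same image
-- have root walks with the same image, and zipping them shows that the kernel
-- pair is itself a tree of height ≤ k; both projections are pathwise
-- embeddings equalised by f, so monicity forces them to agree.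
module Submission where

open import Defs
open import Axiom.UniquenessOfIdentityProofs.WithK using (uip)
open import Data.Empty using (⊥-elim)
open import Data.List using (List; []; _∷_; map; _∷ʳ_)
open import Data.List.Properties using (∷-injectiveˡ; ∷-injectiveʳ; ∷ʳ-injectiveˡ; length-map)
open import Data.Product using (Σ; ∃; _×_; _,_; proj₁; proj₂)
open import Data.Sum using (_⊎_; inj₁; inj₂)
open import Function using (_⇔_; mk⇔)
open import Relation.Nullary using (¬_)
open import Relation.Binary.PropositionalEquality

module _ {X : Set} {R : X → X → Set} where

  walk-snoc : ∀ {c x y xs} → Walk R c x xs → R x y → Walk R c y (xs ∷ʳ y)
  walk-snoc one r = step r one
  walk-snoc (step r' w) r = step r' (walk-snoc w r)

  walk-list-nonempty : ∀ {c x xs} → Walk R c x xs → ¬ xs ≡ []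
  walk-list-nonempty one ()
  walk-list-nonempty (step _ _) ()

  walk-target-unique : ∀ {c c' x x' xs} → Walk R c x xs → Walk R c' x' xs → x ≡ x'
  walk-target-unique one one = refl
  walk-target-unique (step _ w) (step _ w') = walk-target-unique w w'
  walk-target-unique one (step _ ())
  walk-target-unique (step _ ()) one

  walk-trivial-or-last-step : ∀ {c x xs} → Walk R c x xs → x ≡ c ⊎ ∃ λ u → R u x
  walk-trivial-or-last-step one = inj₁ refl
  walk-trivial-or-last-step (step r w) with walk-trivial-or-last-step w
  ... | inj₁ refl = inj₂ (_ , r)
  ... | inj₂ last = inj₂ last

walk-map : {X Y : Set} {R : X → X → Set} {S : Y → Y → Set} (F : X → Y) →
  (∀ {a b} → R a b → S (F a) (F b)) →
  ∀ {c x xs} → Walk R c x xs → Walk S (F c) (F x) (map F xs)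
walk-map F pres one = one
walk-map F pres (step r w) = step (pres r) (walk-map F pres w)

module _ {I : Set} {M : KripkeModel I} (tree : IsSyncTree M) where

  private
    walk-from-root : ∀ x → Σ (List (Carrier M)) (Walk (R M) (root M) x)
    walk-from-root = proj₁ tree

    root-walk-unique : ∀ x xs ys → Walk (R M) (root M) x xs → Walk (R M) (root M) x ys → xs ≡ ys
    root-walk-unique = proj₂ tree

  root-has-no-parent : ∀ {u} → ¬ R M u (root M)
  root-has-no-parent {u} r with walk-from-root u
  ... | us , w = walk-list-nonempty w (∷ʳ-injectiveˡ us [] (root-walk-unique _ _ _ (walk-snoc w r) one))

  parent-unique : ∀ {u u' v} → R M u v → R M u' v → u ≡ u'
  parent-unique {u} {u'} r r' with walk-from-root u | walk-from-root u'
  ... | us , w | us' , w' =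
    walk-target-unique w
      (subst (Walk (R M) (root M) u')
             (sym (∷ʳ-injectiveˡ us us' (root-walk-unique _ _ _ (walk-snoc w r) (walk-snoc w' r'))))
             w')

  root-or-child : ∀ v → v ≡ root M ⊎ ∃ λ u → R M u v
  root-or-child v = walk-trivial-or-last-step (proj₂ (walk-from-root v))

module _ {I : Set} {A B : KripkeModel I} {F : Carrier A → Carrier B}
         (hom : IsHomomorphism A B F) where
  open IsHomomorphism hom

  hom-root-walk : ∀ {x xs} → Walk (R A) (root A) x xs → Walk (R B) (root B) (F x) (map F xs)
  hom-root-walk w = subst (λ c → Walk (R B) c _ _) pres-root (walk-map F pres-R w)

  root-walk-images-agree : IsSyncTree B → ∀ {x y xs ys} → F x ≡ F y →
    Walk (R A) (root A) x xs → Walk (R A) (root A) y ys → map F xs ≡ map F ys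
  root-walk-images-agree treeB {ys = ys} Fx≡Fy wx wy =
    proj₂ treeB _ _ _ (hom-root-walk wx)
      (subst (λ z → Walk (R B) (root B) z (map F ys)) (sym Fx≡Fy) (hom-root-walk wy))

  injective-hom-reflects-R : IsSyncTree A → IsSyncTree B → Injective F →
    ∀ {x y} → R B (F x) (F y) → R A x y
  injective-hom-reflects-R treeA treeB inj {x} {y} r with root-or-child {M = A} treeA y
  ... | inj₁ refl = ⊥-elim (root-has-no-parent {M = B} treeB (subst (R B (F x)) pres-root r))
  ... | inj₂ (u , u→y) = subst (λ z → R A z y) (inj (parent-unique {M = B} treeB (pres-R u→y) r)) u→y

module KernelPair {I : Set} {k : Height} {A B : SyncTree I k} (f : SMor A B) where
  private
    MA : KripkeModel I
    MA = model A

    F : Carrier MA → Carrier (model B)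
    F = fun f
    open IsPathwiseEmbedding (isPE f)
    open IsHomomorphism hom

  record Pair : Set where
    constructor _,_∣_
    field
      fst snd : Carrier MA
      same    : F fst ≡ F snd
  open Pair

  pair-≡ : ∀ {a a' b b'} {e : F a ≡ F b} {e' : F a' ≡ F b'} →
    a ≡ a' → b ≡ b' → (a , b ∣ e) ≡ (a' , b' ∣ e')
  pair-≡ refl refl = cong (_ , _ ∣_) (uip _ _)

  map-fst-snd-injective : ∀ {us vs} → map fst us ≡ map fst vs → map snd us ≡ map snd vs → us ≡ vs
  map-fst-snd-injective {[]} {[]} _ _ = refl
  map-fst-snd-injective {u ∷ us} {v ∷ vs} p q =
    cong₂ _∷_ (pair-≡ (∷-injectiveˡ p) (∷-injectiveˡ q))
              (map-fst-snd-injective (∷-injectiveʳ p) (∷-injectiveʳ q))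

  Step : Pair → Pair → Set
  Step u v = R MA (fst u) (fst v) × R MA (snd u) (snd v)

  source-images-agree : ∀ {a b a' b' as bs} →
    Walk (R MA) a a' as → Walk (R MA) b b' bs → map F as ≡ map F bs → F a ≡ F b
  source-images-agree one one p = ∷-injectiveˡ p
  source-images-agree one (step _ _) p = ∷-injectiveˡ p
  source-images-agree (step _ _) one p = ∷-injectiveˡ p
  source-images-agree (step _ _) (step _ _) p = ∷-injectiveˡ p

  zip-walks : ∀ {a b a' b' as bs} (e : F a ≡ F b) (e' : F a' ≡ F b') →
    Walk (R MA) a a' as → Walk (R MA) b b' bs → map F as ≡ map F bs →
    Σ (List Pair) (Walk Step (a , b ∣ e) (a' , b' ∣ e'))
  zip-walks {a} {b} e e' one one _ =
    _ , subst (λ u → Walk Step u (a , b ∣ e') ((a , b ∣ e') ∷ [])) (pair-≡ refl refl) one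
  zip-walks e e' (step r wa) (step s wb) p
    with zip-walks (source-images-agree wa wb (∷-injectiveʳ p)) e' wa wb (∷-injectiveʳ p)
  ... | zs , w = _ , step (r , s) w
  zip-walks e e' one (step _ one) ()
  zip-walks e e' one (step _ (step _ _)) ()
  zip-walks e e' (step _ one) one ()
  zip-walks e e' (step _ (step _ _)) one ()

  model-κ : KripkeModel I
  model-κ = record
    { Carrier = Pair
    ; R       = Step
    ; P       = λ i u → P MA i (fst u)
    ; root    = root MA , root MA ∣ refl
    }

  private
    fst-walk : ∀ {u us} → Walk Step (root model-κ) u us → Walk (R MA) (root MA) (fst u) (map fst us)
    fst-walk = walk-map fst proj₁

    snd-walk : ∀ {u us} → Walk Step (root model-κ) u us → Walk (R MA) (root MA) (snd u) (map snd us)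
    snd-walk = walk-map snd proj₂

  isTree-κ : IsSyncTree model-κ
  isTree-κ = reach , unique
    where
    reach : ∀ u → Σ (List Pair) (Walk Step (root model-κ) u)
    reach (a , b ∣ e) with proj₁ (isTree A) a | proj₁ (isTree A) b
    ... | as , wa | bs , wb =
      zip-walks refl e wa wb (root-walk-images-agree hom (isTree B) e wa wb)

    unique : ∀ u us vs → Walk Step (root model-κ) u us → Walk Step (root model-κ) u vs → us ≡ vs
    unique u us vs w w' = map-fst-snd-injective
      (proj₂ (isTree A) _ _ _ (fst-walk w) (fst-walk w'))
      (proj₂ (isTree A) _ _ _ (snd-walk w) (snd-walk w'))

  κ : SyncTree I k
  κ = record
    { model  = model-κ
    ; isTree = isTree-κ
    ; height = λ u us w → subst (_≤ₕ k) (length-map fst us) (height A (fst u) _ (fst-walk w))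
    }

  π₁ : SMor κ A
  π₁ = record
    { fun  = fst
    ; isPE = record
      { hom       = record { pres-R = proj₁ ; pres-P = λ _ p → p ; pres-root = refl }
      ; reflect-P = λ _ p → p
      }
    }

  π₂ : SMor κ A
  π₂ = record
    { fun  = snd
    ; isPE = record
      { hom       = record
        { pres-R    = proj₂
        ; pres-P    = λ i {u} p → reflect-P i (subst (P (model B) i) (same u) (pres-P i p))
        ; pres-root = refl
        }
      ; reflect-P = λ i {u} p → reflect-P i (subst (P (model B) i) (sym (same u)) (pres-P i p))
      }
    }

  mono⇒injective : IsMonoS f → Injective F
  mono⇒injective mono {x} {y} Fx≡Fy = mono κ π₁ π₂ same (x , y ∣ Fx≡Fy)

injective⇒embedding : ∀ {I k} {A B : SyncTree I k} (f : SMor A B) →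
  Injective (fun f) → IsEmbedding (model A) (model B) (fun f)
injective⇒embedding {A = A} {B} f inj = record
  { injective = inj
  ; hom       = hom
  ; reflect-P = reflect-P
  ; reflect-R = injective-hom-reflects-R hom (isTree A) (isTree B) inj
  }
  where open IsPathwiseEmbedding (isPE f)

lemma3p5 : {I : Set} {k : Height} {A B : SyncTree I k} (f : SMor A B) →
    (IsMonoS f ⇔ Injective (fun f))
      × (Injective (fun f) ⇔ IsEmbedding (model A) (model B) (fun f))
lemma3p5 f =
  mk⇔ (KernelPair.mono⇒injective f) (λ inj C g h fg≡fh c → inj (fg≡fh c)) ,
  mk⇔ (injective⇒embedding f) IsEmbedding.injective
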